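{- For every integer $k\ge 0$, $r_k=a_{k,k}$.
   Context: For nonnegative integers $p,q$, let $a_{p,q}$ be the number of ways to partition a set consisting of $p$ marked points on a line and $q$ marked points on a parallel line into pairs, joining the two points of each pair by a straight segment, such that no two segments have a common point (in particular, no endpoint lies on another segment). We have $a_{0,0}=1$. Consider lattice paths consisting of steps of four kinds, each with a cost: - an up step $(1,1)$ of cost $3/2$; - a down step $(1,-1)$ of cost $3/2$; - a "cheap" horizontal step $(1,0)$ of cost $1$; - a "luxury" horizontal step $(1,0)$ of cost $2$. The two kinds of horizontal steps are distinguished. The cost of a path is the sum of the costs of its steps. $r_k$ is the number of such paths (finite sequences of steps) of total cost $k$ whose starting point and endpoint lie at the same height. There is no restriction that the path stay above its starting level. The empty path is counted, so $r_0=1$. -}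

module Defs where

open import Data.Bool using (Bool; true; false)
import Data.Bool as B
open import Data.Nat using (ℕ; zero; suc; _+_; _*_; _<_)
import Data.Nat as N
open import Data.Nat.Properties using (_<?_)
open import Data.Integer using (ℤ; 0ℤ; 1ℤ; -1ℤ)
import Data.Integer as Z
open import Data.Fin using (Fin; toℕ; splitAt)
import Data.Fin as F
open import Data.Fin.Properties using (all?)
open import Data.Sum using (_⊎_; inj₁; inj₂)
open import Data.List using (List; []; _∷_; map; concatMap; filter; length; allFin; upTo)
open import Data.Vec using (Vec; lookup)
import Data.Vec as V
open import Data.Product using (_×_)
open import Data.Empty using (⊥)
open import Relation.Nullary using (¬_; Dec; yes; no; ¬?)
open import Relation.Nullary.Decidable using (_×-dec_; _→-dec_)
open import Relation.Binary.PropositionalEquality using (_≡_)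

data Step : Set where
  up down cheap luxury : Step

-- Twice the cost of a step (to stay in ℕ):
-- up, down cost 3/2; cheap costs 1; luxury costs 2.
cost2 : Step → ℕ
cost2 up      = 3
cost2 down    = 3
cost2 cheap   = 2
cost2 luxury  = 4

rise : Step → ℤ
rise up      = 1ℤ
rise down    = -1ℤ
rise cheap   = 0ℤ
rise luxury  = 0ℤ

pathCost2 : List Step → ℕ
pathCost2 []       = 0
pathCost2 (s ∷ ss) = cost2 s + pathCost2 ss

height : List Step → ℤ
height []       = 0ℤ
height (s ∷ ss) = rise s Z.+ height ss

allSteps : List Step
allSteps = up ∷ down ∷ cheap ∷ luxury ∷ []

pathsOfLength : ℕ → List (List Step)
pathsOfLength zero    = [] ∷ []
pathsOfLength (suc n) = concatMap (λ s → map (s ∷_) (pathsOfLength n)) allSteps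

pathsUpTo : ℕ → List (List Step)
pathsUpTo n = concatMap pathsOfLength (upTo (suc n))

Balanced : ℕ → List Step → Set
Balanced k ps = (pathCost2 ps ≡ 2 * k) × (height ps ≡ 0ℤ)

balanced? : ∀ k ps → Dec (Balanced k ps)
balanced? k ps = (pathCost2 ps N.≟ 2 * k) ×-dec (height ps Z.≟ 0ℤ)

-- r_k: every step has cost ≥ 1, so a path of cost k has at most k
-- steps; hence all such paths occur in pathsUpTo k.
r : ℕ → ℕ
r k = length (filter (balanced? k) (pathsUpTo k))

-- The p + q marked points are Fin (p + q): the first p lie (in this
-- left-to-right order) on the first line, the remaining q on the second.

-- which line a point is on (false = first line, true = second line)
line : ∀ p q → Fin (p + q) → Bool
line p q x with splitAt p x
... | inj₁ _ = false
... | inj₂ _ = true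

idx : ∀ p q → Fin (p + q) → ℕ
idx p q x with splitAt p x
... | inj₁ i = toℕ i
... | inj₂ j = toℕ j

-- A partition into pairs is encoded by its partner map f
-- (a fixed-point-free involution).
Involutive : ∀ {n} → (Fin n → Fin n) → Set
Involutive f = ∀ x → f (f x) ≡ x

FixedPointFree : ∀ {n} → (Fin n → Fin n) → Set
FixedPointFree f = ∀ x → ¬ (f x ≡ x)

NoPointOnSegment : ∀ p q → (Fin (p + q) → Fin (p + q)) → Set
NoPointOnSegment p q f =
  ∀ x z → line p q x ≡ line p q (f x) → line p q z ≡ line p q x →
  idx p q x < idx p q z → idx p q z < idx p q (f x) → ⊥

NoCrossing : ∀ p q → (Fin (p + q) → Fin (p + q)) → Set
NoCrossing p q f =
  ∀ x y → line p q x ≡ false → line p q (f x) ≡ true →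
  line p q y ≡ false → line p q (f y) ≡ true →
  idx p q x < idx p q y → idx p q (f x) < idx p q (f y)

-- Valid configurations: pairings whose segments are pairwise disjoint.
ValidPairing : ∀ p q → Vec (Fin (p + q)) (p + q) → Set
ValidPairing p q m =
  Involutive (lookup m) × FixedPointFree (lookup m) ×
  NoPointOnSegment p q (lookup m) × NoCrossing p q (lookup m)

validPairing? : ∀ p q m → Dec (ValidPairing p q m)
validPairing? p q m =
  all? (λ x → f (f x) F.≟ x) ×-dec
  all? (λ x → ¬? (f x F.≟ x)) ×-dec
  all? (λ x → all? (λ z →
     (line p q x B.≟ line p q (f x)) →-dec (line p q z B.≟ line p q x) →-dec
     (idx p q x <? idx p q z) →-dec (idx p q z <? idx p q (f x)) →-dec
     no (λ ()))) ×-dec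
  all? (λ x → all? (λ y →
     (line p q x B.≟ false) →-dec (line p q (f x) B.≟ true) →-dec
     (line p q y B.≟ false) →-dec (line p q (f y) B.≟ true) →-dec
     (idx p q x <? idx p q y) →-dec (idx p q (f x) <? idx p q (f y))))
  where f = lookup m

allVecs : ∀ n m → List (Vec (Fin m) n)
allVecs zero    m = V.[] ∷ []
allVecs (suc n) m = concatMap (λ x → map (x V.∷_) (allVecs n m)) (allFin m)

a : ℕ → ℕ → ℕ
a p q = length (filter (validPairing? p q) (allVecs (p + q) (p + q)))

module Submission where

-- Both sides count pairs of words over the parts
-- {1, 2}.  In a valid pairing every segment inside a line joins two
-- neighbouring points (a part 2); the remaining points (parts 1) are joined
-- to the other line, and since cross segments do not cross, the n-th such
-- point of line 1 is joined to the n-th of line 2.  So valid pairings of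
-- p + q points correspond to pairs of compositions of p and q into parts 1
-- and 2 with equally many 1s ("compatible" words).  A path step contributes
-- a part to each word (up = (1,2), down = (2,1), cheap = (1,1), luxury =
-- (2,2)): twice its cost is the sum and its rise the difference of 1-counts,
-- so balanced paths of cost k are compatible pairs of compositions of k.

open import Defs
open import Data.Nat using (ℕ; _+_)
open import Relation.Binary.PropositionalEquality using (_≡_)

module Counting where

  open import Data.List using (List; []; _∷_; map; filter; length)
  open import Data.List.Properties using (length-map)
  open import Data.List.Relation.Unary.All using (All; []; _∷_)
  import Data.List.Relation.Unary.All as All
  open import Data.List.Relation.Unary.All.Properties using (all-filter; map⁺)
  open import Data.List.Relation.Unary.Unique.Propositional using (Unique; []; _∷_)
  open import Data.List.Relation.Unary.Unique.Propositional.Properties using (filter⁺)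
  open import Data.List.Membership.Propositional using (_∈_)
  open import Data.List.Membership.Propositional.Properties
    using (∈-map⁺; ∈-map⁻; ∈-filter⁺; ∈-filter⁻)
  open import Data.List.Membership.Propositional.Properties.WithK using (unique∧set⇒bag)
  open import Data.List.Relation.Binary.BagAndSetEquality using (∼bag⇒↭)
  open import Data.List.Relation.Binary.Permutation.Propositional.Properties using (↭-length)
  open import Data.Product using (_,_)
  open import Function.Bundles using (mk⇔)
  open import Relation.Unary using (Decidable)
  open import Relation.Binary.PropositionalEquality using (refl; sym; trans; cong; subst)

  map-unique : ∀ {A B : Set} {P : A → Set} (f : A → B) →
    (∀ {x y} → P x → P y → f x ≡ f y → x ≡ y) →
    ∀ {xs} → All P xs → Unique xs → Unique (map f xs)
  map-unique f inj [] [] = []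
  map-unique f inj (px ∷ pxs) (x∉xs ∷ u) =
    map⁺ (All.zipWith (λ (py , x≢y) fx≡fy → x≢y (inj px py fx≡fy)) (pxs , x∉xs))
      ∷ map-unique f inj pxs u

  length-filter-bijection : ∀ {A B : Set} {P : A → Set} {Q : B → Set}
    (P? : Decidable P) (Q? : Decidable Q) (xs : List A) (ys : List B) →
    Unique xs → Unique ys → (∀ x → P x → x ∈ xs) → (∀ y → Q y → y ∈ ys) →
    (f : A → B) (g : B → A) → (∀ x → P x → Q (f x)) → (∀ y → Q y → P (g y)) →
    (∀ x → P x → g (f x) ≡ x) → (∀ y → Q y → f (g y) ≡ y) →
    length (filter P? xs) ≡ length (filter Q? ys)
  length-filter-bijection {P = P} {Q} P? Q? xs ys uxs uys xs-complete ys-complete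
                          f g f-PQ g-QP gf fg =
    trans (sym (length-map f (filter P? xs)))
      (↭-length (∼bag⇒↭ (unique∧set⇒bag image-unique (filter⁺ Q? uys) (mk⇔ to from))))
    where
    f-injective : ∀ {x y} → P x → P y → f x ≡ f y → x ≡ y
    f-injective {x} {y} px py e = trans (sym (gf x px)) (trans (cong g e) (gf y py))

    image-unique : Unique (map f (filter P? xs))
    image-unique = map-unique f f-injective (all-filter P? xs) (filter⁺ P? uxs)

    to : ∀ {y} → y ∈ map f (filter P? xs) → y ∈ filter Q? ys
    to y∈ with ∈-map⁻ f y∈
    ... | x , x∈ , refl with ∈-filter⁻ P? {xs = xs} x∈
    ...   | _ , px = ∈-filter⁺ Q? (ys-complete (f x) (f-PQ x px)) (f-PQ x px)

    from : ∀ {y} → y ∈ filter Q? ys → y ∈ map f (filter P? xs)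
    from {y} y∈ with ∈-filter⁻ Q? {xs = ys} y∈
    ... | _ , qy = subst (_∈ map f (filter P? xs)) (fg y qy)
                     (∈-map⁺ f (∈-filter⁺ P? (xs-complete (g y) (g-QP y qy)) (g-QP y qy)))

module Enumerations where

  open import Data.Nat using (zero; suc; _≤_; s≤s)
  open import Data.Fin using (Fin)
  open import Data.Vec using (Vec)
  import Data.Vec as V
  import Data.Vec.Properties as Vec
  open import Data.List using (List; []; _∷_; map; length; concatMap)
  import Data.List.Properties as List
  open import Data.List.Relation.Unary.All using ([]; _∷_)
  import Data.List.Relation.Unary.All as All
  open import Data.List.Relation.Unary.All.Properties using () renaming (map⁺ to All-map⁺)
  import Data.List.Relation.Unary.AllPairs as AllPairs
  open import Data.List.Relation.Unary.AllPairs.Properties using () renaming (map⁺ to AllPairs-map⁺)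
  open import Data.List.Relation.Unary.Any using (here; there; satisfied)
  import Data.List.Relation.Unary.Any as Any
  open import Data.List.Relation.Unary.Unique.Propositional using (Unique; []; _∷_)
  open import Data.List.Relation.Unary.Unique.Propositional.Properties
    using (concat⁺; upTo⁺; allFin⁺) renaming (map⁺ to Unique-map⁺)
  open import Data.List.Relation.Binary.Disjoint.Propositional using (Disjoint)
  open import Data.List.Membership.Propositional using (_∈_)
  open import Data.List.Membership.Propositional.Properties
    using (∈-map⁺; ∈-map⁻; ∈-concatMap⁺; ∈-concatMap⁻; ∈-upTo⁺; ∈-allFin)
  open import Data.Product using (_×_; _,_; proj₁; proj₂)
  open import Relation.Nullary using (¬_)
  open import Relation.Binary.PropositionalEquality using (refl; sym; trans; cong)

  concatMap-unique : ∀ {A B : Set} (g : A → List B) {xs : List A} → Unique xs →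
    (∀ x → Unique (g x)) → (∀ {x y} → ¬ x ≡ y → Disjoint (g x) (g y)) →
    Unique (concatMap g xs)
  concatMap-unique g u g-unique g-disjoint =
    concat⁺ (All-map⁺ (All.universal g-unique _)) (AllPairs-map⁺ (AllPairs.map g-disjoint u))

  -- All values c x y with x from xs and y from ys; allVecs and
  -- pathsOfLength are built this way.
  products : ∀ {A B C : Set} → (A → B → C) → List A → List B → List C
  products c xs ys = concatMap (λ x → map (c x) ys) xs

  products-complete : ∀ {A B C : Set} (c : A → B → C) {xs ys x y} →
    x ∈ xs → y ∈ ys → c x y ∈ products c xs ys
  products-complete c {ys = ys} x∈ y∈ =
    ∈-concatMap⁺ (λ x → map (c x) ys) (Any.map (λ { refl → ∈-map⁺ (c _) y∈ }) x∈)

  products-unique : ∀ {A B C : Set} (c : A → B → C) {xs ys} →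
    (∀ {x x' y y'} → c x y ≡ c x' y' → x ≡ x' × y ≡ y') →
    Unique xs → Unique ys → Unique (products c xs ys)
  products-unique {A} {B} {C} c {xs} {ys} c-injective uxs uys =
    concatMap-unique row uxs (λ x → Unique-map⁺ (λ e → proj₂ (c-injective e)) uys) rows-disjoint
    where
    row : A → List C
    row x = map (c x) ys

    rows-disjoint : ∀ {x x'} → ¬ x ≡ x' → Disjoint (row x) (row x')
    rows-disjoint x≢x' (z∈ , z∈') with ∈-map⁻ (c _) z∈ | ∈-map⁻ (c _) z∈'
    ... | _ , _ , refl | _ , _ , e = x≢x' (proj₁ (c-injective e))

  allVecs-complete : ∀ n m (v : Vec (Fin m) n) → v ∈ allVecs n m
  allVecs-complete zero m V.[] = here refl
  allVecs-complete (suc n) m (x V.∷ v) =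
    products-complete V._∷_ (∈-allFin x) (allVecs-complete n m v)

  allVecs-unique : ∀ n m → Unique (allVecs n m)
  allVecs-unique zero m = [] ∷ []
  allVecs-unique (suc n) m =
    products-unique V._∷_ Vec.∷-injective (allFin⁺ m) (allVecs-unique n m)

  allSteps-complete : ∀ s → s ∈ allSteps
  allSteps-complete up     = here refl
  allSteps-complete down   = there (here refl)
  allSteps-complete cheap  = there (there (here refl))
  allSteps-complete luxury = there (there (there (here refl)))

  allSteps-unique : Unique allSteps
  allSteps-unique =
    ((λ ()) ∷ (λ ()) ∷ (λ ()) ∷ []) ∷ ((λ ()) ∷ (λ ()) ∷ []) ∷ ((λ ()) ∷ []) ∷ [] ∷ []

  pathsOfLength-complete : ∀ (ps : List Step) → ps ∈ pathsOfLength (length ps)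
  pathsOfLength-complete [] = here refl
  pathsOfLength-complete (s ∷ ps) =
    products-complete _∷_ (allSteps-complete s) (pathsOfLength-complete ps)

  pathsOfLength-length : ∀ n {ps} → ps ∈ pathsOfLength n → length ps ≡ n
  pathsOfLength-length zero (here refl) = refl
  pathsOfLength-length (suc n) ps∈
    with satisfied (∈-concatMap⁻ (λ s → map (s ∷_) (pathsOfLength n)) {xs = allSteps} ps∈)
  ... | s , ps∈row with ∈-map⁻ (s ∷_) ps∈row
  ...   | qs , qs∈ , refl = cong suc (pathsOfLength-length n qs∈)

  pathsOfLength-unique : ∀ n → Unique (pathsOfLength n)
  pathsOfLength-unique zero = [] ∷ []
  pathsOfLength-unique (suc n) =
    products-unique _∷_ List.∷-injective allSteps-unique (pathsOfLength-unique n)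

  -- Paths of different lengths are different, so listing the paths of
  -- each length at most k produces no duplicates.
  pathsUpTo-unique : ∀ k → Unique (pathsUpTo k)
  pathsUpTo-unique k = concatMap-unique pathsOfLength (upTo⁺ (suc k)) pathsOfLength-unique
    (λ m≢n (ps∈m , ps∈n) →
      m≢n (trans (sym (pathsOfLength-length _ ps∈m)) (pathsOfLength-length _ ps∈n)))

  pathsUpTo-complete : ∀ k ps → length ps ≤ k → ps ∈ pathsUpTo k
  pathsUpTo-complete k ps ≤k =
    ∈-concatMap⁺ pathsOfLength
      (Any.map (λ { refl → pathsOfLength-complete ps }) (∈-upTo⁺ (s≤s ≤k)))

-- A path is the same thing as a pair of words of equal length over the
-- parts 1 and 2: each step records one part for each line.
module Compositions where

  open import Data.Nat using (suc; _+_; _*_; _≤_; z≤n; s≤s)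
  open import Data.Nat.Properties
    using (suc-injective; +-suc; +-identityʳ; +-cancelʳ-≡; *-cancelˡ-≡; m≤n⇒m≤1+n;
           +-commutativeSemigroup; module ≤-Reasoning)
  open import Algebra.Properties.CommutativeSemigroup +-commutativeSemigroup using (interchange)
  open import Data.Integer using (0ℤ; 1ℤ; -1ℤ; _⊖_)
  import Data.Integer as ℤ
  import Data.Integer.Properties as ℤ
  open import Data.List using (List; []; _∷_; map; length)
  open import Data.List.Properties using (length-map)
  open import Data.Product using (_×_; _,_; proj₁; proj₂)
  open import Relation.Binary.PropositionalEquality
    using (refl; sym; trans; cong; cong₂; module ≡-Reasoning)

  -- On one line, a point is either a singleton (joined to the other line)
  -- or the left end of a segment joining two neighbouring points.
  data Part : Set where
    one two : Part

  Word : Set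
  Word = List Part

  weight : Part → ℕ
  weight one = 1
  weight two = 2

  total : Word → ℕ
  total []      = 0
  total (x ∷ w) = weight x + total w

  ones : Word → ℕ
  ones []        = 0
  ones (one ∷ w) = suc (ones w)
  ones (two ∷ w) = ones w

  length-≤-total : ∀ w → length w ≤ total w
  length-≤-total []        = z≤n
  length-≤-total (one ∷ w) = s≤s (length-≤-total w)
  length-≤-total (two ∷ w) = s≤s (m≤n⇒m≤1+n (length-≤-total w))

  -- Each part contributes 2 to its weight plus its number of singletons.
  total+ones : ∀ w → total w + ones w ≡ 2 * length w
  total+ones [] = refl
  total+ones (one ∷ w) = cong suc (begin
    total w + suc (ones w)            ≡⟨ +-suc (total w) (ones w) ⟩
    suc (total w + ones w)            ≡⟨ cong suc (total+ones w) ⟩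
    suc (length w + (length w + 0))   ≡⟨ +-suc (length w) (length w + 0) ⟨
    length w + suc (length w + 0)     ∎)
    where open ≡-Reasoning
  total+ones (two ∷ w) =
    cong suc (trans (cong suc (total+ones w)) (sym (+-suc (length w) (length w + 0))))

  first second : Step → Part
  first up      = one
  first down    = two
  first cheap   = one
  first luxury  = two
  second up     = two
  second down   = one
  second cheap  = one
  second luxury = two

  step : Part → Part → Step
  step one two = up
  step two one = down
  step one one = cheap
  step two two = luxury

  zipSteps : Word → Word → List Step
  zipSteps (x ∷ w₁) (y ∷ w₂) = step x y ∷ zipSteps w₁ w₂
  zipSteps _        _        = []

  zip-unzip : ∀ ps → zipSteps (map first ps) (map second ps) ≡ ps
  zip-unzip []             = refl
  zip-unzip (up ∷ ps)      = cong (up ∷_) (zip-unzip ps)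
  zip-unzip (down ∷ ps)    = cong (down ∷_) (zip-unzip ps)
  zip-unzip (cheap ∷ ps)   = cong (cheap ∷_) (zip-unzip ps)
  zip-unzip (luxury ∷ ps)  = cong (luxury ∷_) (zip-unzip ps)

  first-step : ∀ x y → first (step x y) ≡ x
  first-step one one = refl
  first-step one two = refl
  first-step two one = refl
  first-step two two = refl

  second-step : ∀ x y → second (step x y) ≡ y
  second-step one one = refl
  second-step one two = refl
  second-step two one = refl
  second-step two two = refl

  unzip-zip : ∀ w₁ w₂ → length w₁ ≡ length w₂ →
    map first (zipSteps w₁ w₂) ≡ w₁ × map second (zipSteps w₁ w₂) ≡ w₂
  unzip-zip []       []       _  = refl , refl
  unzip-zip (x ∷ w₁) (y ∷ w₂) eq with unzip-zip w₁ w₂ (suc-injective eq)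
  ... | e₁ , e₂ = cong₂ _∷_ (first-step x y) e₁ , cong₂ _∷_ (second-step x y) e₂

  step-cost : ∀ s → cost2 s ≡ weight (first s) + weight (second s)
  step-cost up     = refl
  step-cost down   = refl
  step-cost cheap  = refl
  step-cost luxury = refl

  cost-split : ∀ ps → pathCost2 ps ≡ total (map first ps) + total (map second ps)
  cost-split []       = refl
  cost-split (s ∷ ps) =
    trans (cong₂ _+_ (step-cost s) (cost-split ps))
      (interchange (weight (first s)) (weight (second s)) (total (map first ps)) (total (map second ps)))

  height-split : ∀ ps → height ps ≡ ones (map first ps) ⊖ ones (map second ps)
  height-split [] = refl
  height-split (up ∷ ps) =
    trans (cong (λ h → 1ℤ ℤ.+ h) (height-split ps))
          (ℤ.distribʳ-⊖-+-pos 1 (ones (map first ps)) (ones (map second ps)))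
  height-split (down ∷ ps) =
    trans (cong (λ h → -1ℤ ℤ.+ h) (height-split ps))
          (ℤ.distribʳ-⊖-+-neg 0 (ones (map first ps)) (ones (map second ps)))
  height-split (cheap ∷ ps) =
    trans (ℤ.+-identityˡ (height ps))
      (trans (height-split ps) (sym (ℤ.[1+m]⊖[1+n]≡m⊖n (ones (map first ps)) (ones (map second ps)))))
  height-split (luxury ∷ ps) = trans (ℤ.+-identityˡ (height ps)) (height-split ps)

  ⊖≡0⇒≡ : ∀ m n → m ⊖ n ≡ 0ℤ → m ≡ n
  ⊖≡0⇒≡ m n e = ℤ.+-injective (ℤ.i-j≡0⇒i≡j (ℤ.+ m) (ℤ.+ n) (trans (ℤ.m-n≡m⊖n m n) e))

  record Compatible (p q : ℕ) (w₁ w₂ : Word) : Set where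
    constructor compatible
    field
      total₁    : total w₁ ≡ p
      total₂    : total w₂ ≡ q
      same-ones : ones w₁ ≡ ones w₂

  compatible-two₁ : ∀ {a b w₁ w₂} → Compatible a b w₁ w₂ →
    Compatible (suc (suc a)) b (two ∷ w₁) w₂
  compatible-two₁ (compatible t₁ t₂ o) = compatible (cong (λ t → suc (suc t)) t₁) t₂ o

  compatible-two₂ : ∀ {a b w₁ w₂} → Compatible a b w₁ w₂ →
    Compatible a (suc (suc b)) w₁ (two ∷ w₂)
  compatible-two₂ (compatible t₁ t₂ o) = compatible t₁ (cong (λ t → suc (suc t)) t₂) o

  compatible-ones : ∀ {a b w₁ w₂} → Compatible a b w₁ w₂ →
    Compatible (suc a) (suc b) (one ∷ w₁) (one ∷ w₂)
  compatible-ones (compatible t₁ t₂ o) = compatible (cong suc t₁) (cong suc t₂) (cong suc o)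

  compatible⇒same-length : ∀ k w₁ w₂ → Compatible k k w₁ w₂ → length w₁ ≡ length w₂
  compatible⇒same-length k w₁ w₂ (compatible t₁ t₂ o) =
    *-cancelˡ-≡ (length w₁) (length w₂) 2 (begin
    2 * length w₁      ≡⟨ total+ones w₁ ⟨
    total w₁ + ones w₁ ≡⟨ cong₂ _+_ (trans t₁ (sym t₂)) o ⟩
    total w₂ + ones w₂ ≡⟨ total+ones w₂ ⟩
    2 * length w₂      ∎)
    where open ≡-Reasoning

  balanced⇒compatible : ∀ k ps → Balanced k ps → Compatible k k (map first ps) (map second ps)
  balanced⇒compatible k ps (cost≡ , height≡0) =
    compatible t₁≡k (trans (sym t₁≡t₂) t₁≡k) o₁≡o₂
    where
    open ≡-Reasoning
    w₁ w₂ : Word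
    w₁ = map first ps
    w₂ = map second ps
    o₁≡o₂ : ones w₁ ≡ ones w₂
    o₁≡o₂ = ⊖≡0⇒≡ (ones w₁) (ones w₂) (trans (sym (height-split ps)) height≡0)
    t₁≡t₂ : total w₁ ≡ total w₂
    t₁≡t₂ = +-cancelʳ-≡ (ones w₁) (total w₁) (total w₂) (begin
      total w₁ + ones w₁ ≡⟨ total+ones w₁ ⟩
      2 * length w₁      ≡⟨ cong (2 *_) (trans (length-map first ps) (sym (length-map second ps))) ⟩
      2 * length w₂      ≡⟨ total+ones w₂ ⟨
      total w₂ + ones w₂ ≡⟨ cong (total w₂ +_) o₁≡o₂ ⟨
      total w₂ + ones w₁ ∎)
    t₁≡k : total w₁ ≡ k
    t₁≡k = *-cancelˡ-≡ (total w₁) k 2 (begin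
      total w₁ + (total w₁ + 0) ≡⟨ cong (total w₁ +_) (trans (+-identityʳ (total w₁)) t₁≡t₂) ⟩
      total w₁ + total w₂       ≡⟨ cost-split ps ⟨
      pathCost2 ps              ≡⟨ cost≡ ⟩
      2 * k                     ∎)

  compatible⇒balanced : ∀ k w₁ w₂ → Compatible k k w₁ w₂ → Balanced k (zipSteps w₁ w₂)
  compatible⇒balanced k w₁ w₂ c@(compatible t₁ t₂ o) = cost≡ , height≡0
    where
    open ≡-Reasoning
    ps : List Step
    ps = zipSteps w₁ w₂
    e₁ : map first ps ≡ w₁
    e₁ = proj₁ (unzip-zip w₁ w₂ (compatible⇒same-length k w₁ w₂ c))
    e₂ : map second ps ≡ w₂
    e₂ = proj₂ (unzip-zip w₁ w₂ (compatible⇒same-length k w₁ w₂ c))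
    cost≡ : pathCost2 ps ≡ 2 * k
    cost≡ = begin
      pathCost2 ps                                 ≡⟨ cost-split ps ⟩
      total (map first ps) + total (map second ps) ≡⟨ cong₂ (λ u v → total u + total v) e₁ e₂ ⟩
      total w₁ + total w₂                          ≡⟨ cong₂ _+_ t₁ t₂ ⟩
      k + k                                        ≡⟨ cong (k +_) (+-identityʳ k) ⟨
      2 * k                                        ∎
    height≡0 : height ps ≡ 0ℤ
    height≡0 = begin
      height ps                                  ≡⟨ height-split ps ⟩
      ones (map first ps) ⊖ ones (map second ps) ≡⟨ cong₂ (λ u v → ones u ⊖ ones v) e₁ e₂ ⟩
      ones w₁ ⊖ ones w₂                          ≡⟨ cong (_⊖ ones w₂) o ⟩
      ones w₂ ⊖ ones w₂                          ≡⟨ ℤ.n⊖n≡0 (ones w₂) ⟩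
      0ℤ                                         ∎

  balanced-length : ∀ k ps → Balanced k ps → length ps ≤ k
  balanced-length k ps b with balanced⇒compatible k ps b
  ... | compatible t₁ _ _ = begin
    length ps                ≡⟨ length-map first ps ⟨
    length (map first ps)    ≤⟨ length-≤-total (map first ps) ⟩
    total (map first ps)     ≡⟨ t₁ ⟩
    k                        ∎
    where open ≤-Reasoning

-- Pairings are handled as maps on points (ℓ , m) = "the m-th point of
-- line ℓ", restricted to a window of consecutive points on each line.
module Pairings where

  open import Data.Bool using (Bool; true; false)
  import Data.Bool as Bool
  open import Data.Nat using (suc; _+_; _≤_; _<_; z≤n; s≤s; s≤s⁻¹)
  import Data.Nat as ℕ
  open import Data.Nat.Properties
    using (≤-refl; <⇒≤; <⇒≱; <-asym; <-trans; +-suc; +-identityʳ; n≮n; ≤-<-trans; m<m+n;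
           m≤n⇒m<n∨m≡n)
  open import Data.Product using (_×_; _,_; proj₁; proj₂)
  open import Data.Product.Properties using (≡-dec)
  open import Data.Sum using (_⊎_; inj₁; inj₂)
  open import Data.Empty using (⊥; ⊥-elim)
  open import Relation.Nullary using (¬_; yes; no)
  open import Relation.Binary.Definitions using (DecidableEquality)
  open import Relation.Binary.PropositionalEquality
    using (refl; sym; trans; cong; subst; subst₂)

  false≢true : ¬ false ≡ true
  false≢true ()

  Point : Set
  Point = Bool × ℕ

  _≟ₚ_ : DecidableEquality Point
  _≟ₚ_ = ≡-dec Bool._≟_ ℕ._≟_

  join : Point → Point → (Point → Point) → Point → Point
  join a b r x with x ≟ₚ a
  ... | yes _ = b
  ... | no _ with x ≟ₚ b
  ...   | yes _ = a
  ...   | no _  = r x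

  join-a : ∀ a b r → join a b r a ≡ b
  join-a a b r with a ≟ₚ a
  ... | yes _  = refl
  ... | no a≢a = ⊥-elim (a≢a refl)

  join-b : ∀ a b r → ¬ a ≡ b → join a b r b ≡ a
  join-b a b r a≢b with b ≟ₚ a
  ... | yes b≡a = ⊥-elim (a≢b (sym b≡a))
  ... | no _ with b ≟ₚ b
  ...   | yes _  = refl
  ...   | no b≢b = ⊥-elim (b≢b refl)

  join-other : ∀ a b r x → ¬ x ≡ a → ¬ x ≡ b → join a b r x ≡ r x
  join-other a b r x x≢a x≢b with x ≟ₚ a
  ... | yes x≡a = ⊥-elim (x≢a x≡a)
  ... | no _ with x ≟ₚ b
  ...   | yes x≡b = ⊥-elim (x≢b x≡b)
  ...   | no _    = refl

  Window : ℕ → ℕ → ℕ → ℕ → Point → Set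
  Window i j a b (false , m) = i ≤ m × m < i + a
  Window i j a b (true  , m) = j ≤ m × m < j + b

  empty-window : ∀ {i j} x → ¬ Window i j 0 0 x
  empty-window {i} (false , m) (i≤m , m<i+0) =
    n≮n i (≤-<-trans i≤m (subst (m <_) (+-identityʳ i) m<i+0))
  empty-window {j = j} (true , m) (j≤m , m<j+0) =
    n≮n j (≤-<-trans j≤m (subst (m <_) (+-identityʳ j) m<j+0))

  record Peel (R R' : Point → Set) (a : Point) : Set where
    field
      a∈    : R a
      sub   : ∀ x → R' x → R x
      a∉    : ∀ x → R' x → ¬ x ≡ a
      cases : ∀ x → R x → x ≡ a ⊎ R' x

  peel₁ : ∀ {i j a b} → Peel (Window i j (suc a) b) (Window (suc i) j a b) (false , i)
  peel₁ {i} {j} {a} {b} =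
    record { a∈ = ≤-refl , m<m+n i (s≤s z≤n) ; sub = sub ; a∉ = a∉ ; cases = cases }
    where
    sub : ∀ x → Window (suc i) j a b x → Window i j (suc a) b x
    sub (false , m) (i<m , m<) = <⇒≤ i<m , subst (m <_) (sym (+-suc i a)) m<
    sub (true  , m) inside     = inside
    a∉ : ∀ x → Window (suc i) j a b x → ¬ x ≡ (false , i)
    a∉ (false , m) (i<m , _) refl = n≮n i i<m
    cases : ∀ x → Window i j (suc a) b x → x ≡ (false , i) ⊎ Window (suc i) j a b x
    cases (false , m) (i≤m , m<) with m≤n⇒m<n∨m≡n i≤m
    ... | inj₂ refl = inj₁ refl
    ... | inj₁ i<m  = inj₂ (i<m , subst (m <_) (+-suc i a) m<)
    cases (true  , m) inside = inj₂ inside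

  peel₂ : ∀ {i j a b} → Peel (Window i j a (suc b)) (Window i (suc j) a b) (true , j)
  peel₂ {i} {j} {a} {b} =
    record { a∈ = ≤-refl , m<m+n j (s≤s z≤n) ; sub = sub ; a∉ = a∉ ; cases = cases }
    where
    sub : ∀ x → Window i (suc j) a b x → Window i j a (suc b) x
    sub (true  , m) (j<m , m<) = <⇒≤ j<m , subst (m <_) (sym (+-suc j b)) m<
    sub (false , m) inside     = inside
    a∉ : ∀ x → Window i (suc j) a b x → ¬ x ≡ (true , j)
    a∉ (true , m) (j<m , _) refl = n≮n j j<m
    cases : ∀ x → Window i j a (suc b) x → x ≡ (true , j) ⊎ Window i (suc j) a b x
    cases (true , m) (j≤m , m<) with m≤n⇒m<n∨m≡n j≤m
    ... | inj₂ refl = inj₁ refl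
    ... | inj₁ j<m  = inj₂ (j<m , subst (m <_) (+-suc j b) m<)
    cases (false , m) inside = inj₂ inside

  record Split (R R' : Point → Set) (a b : Point) : Set where
    field
      a≢b   : ¬ a ≡ b
      a∈    : R a
      b∈    : R b
      sub   : ∀ x → R' x → R x
      a∉    : ∀ x → R' x → ¬ x ≡ a
      b∉    : ∀ x → R' x → ¬ x ≡ b
      cases : ∀ x → R x → x ≡ a ⊎ x ≡ b ⊎ R' x

  peel-twice : ∀ {R R' R'' a b} → ¬ a ≡ b → Peel R R' a → Peel R' R'' b → Split R R'' a b
  peel-twice {R} {R'} {R''} {a} {b} a≢b P Q = record
    { a≢b = a≢b ; a∈ = P.a∈ ; b∈ = P.sub _ Q.a∈
    ; sub = λ x x∈ → P.sub x (Q.sub x x∈)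
    ; a∉ = λ x x∈ → P.a∉ x (Q.sub x x∈) ; b∉ = Q.a∉
    ; cases = cases }
    where
    module P = Peel P
    module Q = Peel Q
    cases : ∀ x → R x → x ≡ a ⊎ x ≡ b ⊎ R'' x
    cases x x∈ with P.cases x x∈
    ... | inj₁ x≡a = inj₁ x≡a
    ... | inj₂ x∈' with Q.cases x x∈'
    ...   | inj₁ x≡b  = inj₂ (inj₁ x≡b)
    ...   | inj₂ x∈'' = inj₂ (inj₂ x∈'')

  -- The three ways the canonical pairing starts: a segment joining the
  -- first two points of line 1, of line 2, or the first points of both.
  split₁ : ∀ {i j a b} →
    Split (Window i j (suc (suc a)) b) (Window (suc (suc i)) j a b) (false , i) (false , suc i)
  split₁ = peel-twice (λ ()) peel₁ peel₁

  split₂ : ∀ {i j a b} →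
    Split (Window i j a (suc (suc b))) (Window i (suc (suc j)) a b) (true , j) (true , suc j)
  split₂ = peel-twice (λ ()) peel₂ peel₂

  split× : ∀ {i j a b} →
    Split (Window i j (suc a) (suc b)) (Window (suc i) (suc j) a b) (false , i) (true , j)
  split× = peel-twice (λ ()) peel₁ peel₂

  Adjacent : ℕ → ℕ → Set
  Adjacent m n = suc m ≡ n ⊎ suc n ≡ m

  adjacent-sym : ∀ {m n} → Adjacent m n → Adjacent n m
  adjacent-sym (inj₁ e) = inj₂ e
  adjacent-sym (inj₂ e) = inj₁ e

  record PairingOn (R : Point → Set) (f : Point → Point) : Set where
    field
      closed         : ∀ x → R x → R (f x)
      involutive     : ∀ x → R x → f (f x) ≡ x
      no-fixed-point : ∀ x → R x → ¬ f x ≡ x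

  CrossMonotone : (Point → Set) → (Point → Point) → Set
  CrossMonotone R f = ∀ m m' → R (false , m) → R (false , m') →
    proj₁ (f (false , m)) ≡ true → proj₁ (f (false , m')) ≡ true → m < m' →
    proj₂ (f (false , m)) < proj₂ (f (false , m'))

  -- The invariant of the canonical pairings: every segment inside a line
  -- joins two neighbouring points.
  SameLineAdjacent : (Point → Set) → (Point → Point) → Set
  SameLineAdjacent R f = ∀ x → R x → proj₁ (f x) ≡ proj₁ x → Adjacent (proj₂ x) (proj₂ (f x))

  NothingBetween : (Point → Set) → (Point → Point) → Set
  NothingBetween R f = ∀ ℓ m c → R (ℓ , m) → R (ℓ , c) → proj₁ (f (ℓ , m)) ≡ ℓ →
    m < c → c < proj₂ (f (ℓ , m)) → ⊥

  adjacent⇒nothing-between : ∀ {R f} → SameLineAdjacent R f → NothingBetween R f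
  adjacent⇒nothing-between {f = f} adj ℓ m c m∈ c∈ same m<c c<fm with adj (ℓ , m) m∈ same
  ... | inj₁ 1+m≡fm = <⇒≱ m<c (s≤s⁻¹ (subst (c <_) (sym 1+m≡fm) c<fm))
  ... | inj₂ 1+fm≡m = <-asym (<-trans m<c c<fm) (subst (proj₂ (f (ℓ , m)) <_) 1+fm≡m ≤-refl)

  module JoinLemmas {R R' : Point → Set} {a b : Point} (S : Split R R' a b) (r : Point → Point)
    where
    open Split S
    private
      f : Point → Point
      f = join a b r

    join-rest : ∀ x → R' x → f x ≡ r x
    join-rest x x∈ = join-other a b r x (a∉ x x∈) (b∉ x x∈)

    join-pairing : PairingOn R' r → PairingOn R f
    join-pairing P =
      record { closed = closed ; involutive = involutive ; no-fixed-point = no-fixed-point }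
      where
      module P = PairingOn P
      closed : ∀ x → R x → R (f x)
      closed x x∈ with cases x x∈
      ... | inj₁ refl        = subst R (sym (join-a a b r)) b∈
      ... | inj₂ (inj₁ refl) = subst R (sym (join-b a b r a≢b)) a∈
      ... | inj₂ (inj₂ x∈')  = subst R (sym (join-rest x x∈')) (sub (r x) (P.closed x x∈'))
      involutive : ∀ x → R x → f (f x) ≡ x
      involutive x x∈ with cases x x∈
      ... | inj₁ refl        = trans (cong f (join-a a b r)) (join-b a b r a≢b)
      ... | inj₂ (inj₁ refl) = trans (cong f (join-b a b r a≢b)) (join-a a b r)
      ... | inj₂ (inj₂ x∈')  =
        trans (cong f (join-rest x x∈')) (trans (join-rest (r x) (P.closed x x∈')) (P.involutive x x∈'))
      no-fixed-point : ∀ x → R x → ¬ f x ≡ x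
      no-fixed-point x x∈ with cases x x∈
      ... | inj₁ refl        = λ fa≡a → a≢b (sym (trans (sym (join-a a b r)) fa≡a))
      ... | inj₂ (inj₁ refl) = λ fb≡b → a≢b (trans (sym (join-b a b r a≢b)) fb≡b)
      ... | inj₂ (inj₂ x∈')  =
        λ fx≡x → P.no-fixed-point x x∈' (trans (sym (join-rest x x∈')) fx≡x)

    join-adjacent : (proj₁ b ≡ proj₁ a → Adjacent (proj₂ a) (proj₂ b)) →
      SameLineAdjacent R' r → SameLineAdjacent R f
    join-adjacent ab-adjacent adj x x∈ with cases x x∈
    ... | inj₁ refl        rewrite join-a a b r       = ab-adjacent
    ... | inj₂ (inj₁ refl) rewrite join-b a b r a≢b   = λ same → adjacent-sym (ab-adjacent (sym same))
    ... | inj₂ (inj₂ x∈')  rewrite join-rest x x∈'    = adj x x∈'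

    join-monotone-rest : CrossMonotone R' r → ∀ m m' → R' (false , m) → R' (false , m') →
      proj₁ (f (false , m)) ≡ true → proj₁ (f (false , m')) ≡ true → m < m' →
      proj₂ (f (false , m)) < proj₂ (f (false , m'))
    join-monotone-rest mono m m' m∈ m'∈ fm fm' m<m' =
      subst₂ _<_ (sym (cong proj₂ (join-rest _ m∈))) (sym (cong proj₂ (join-rest _ m'∈)))
        (mono m m' m∈ m'∈ (trans (sym (cong proj₁ (join-rest _ m∈))) fm)
                          (trans (sym (cong proj₁ (join-rest _ m'∈))) fm') m<m')

    join-monotone-same-line : proj₁ a ≡ proj₁ b → CrossMonotone R' r → CrossMonotone R f
    join-monotone-same-line same-line mono m m' m∈ m'∈ fm fm' =
      join-monotone-rest mono m m' (crossing-in-rest m m∈ fm) (crossing-in-rest m' m'∈ fm') fm fm'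
      where
      endpoint-same-line : ∀ x → x ≡ a ⊎ x ≡ b → proj₁ (f x) ≡ proj₁ x
      endpoint-same-line x (inj₁ refl) = trans (cong proj₁ (join-a a b r)) (sym same-line)
      endpoint-same-line x (inj₂ refl) = trans (cong proj₁ (join-b a b r a≢b)) same-line
      crossing-in-rest : ∀ m → R (false , m) → proj₁ (f (false , m)) ≡ true → R' (false , m)
      crossing-in-rest m m∈ fm with cases (false , m) m∈
      ... | inj₁ e         = ⊥-elim (false≢true (trans (sym (endpoint-same-line _ (inj₁ e))) fm))
      ... | inj₂ (inj₁ e)  = ⊥-elim (false≢true (trans (sym (endpoint-same-line _ (inj₂ e))) fm))
      ... | inj₂ (inj₂ m∈') = m∈'

    closed-rest : (F : Point → Point) → PairingOn R F → F a ≡ b → ∀ x → R' x → R' (F x)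
    closed-rest F P Fa≡b x x∈ = restrict (cases (F x) (P.closed x (sub x x∈)))
      where
      module P = PairingOn P
      partner : ∀ {y} → F x ≡ y → F y ≡ x
      partner refl = P.involutive x (sub x x∈)
      Fb≡a : F b ≡ a
      Fb≡a = trans (cong F (sym Fa≡b)) (P.involutive a a∈)
      restrict : F x ≡ a ⊎ F x ≡ b ⊎ R' (F x) → R' (F x)
      restrict (inj₁ Fx≡a)        = ⊥-elim (b∉ x x∈ (trans (sym (partner Fx≡a)) Fa≡b))
      restrict (inj₂ (inj₁ Fx≡b)) = ⊥-elim (a∉ x x∈ (trans (sym (partner Fx≡b)) Fb≡a))
      restrict (inj₂ (inj₂ Fx∈))  = Fx∈

    join-agrees : (F : Point → Point) → F a ≡ b → F b ≡ a →
      (∀ x → R' x → r x ≡ F x) → ∀ x → R x → f x ≡ F x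
    join-agrees F Fa≡b Fb≡a agree x x∈ with cases x x∈
    ... | inj₁ refl        = trans (join-a a b r) (sym Fa≡b)
    ... | inj₂ (inj₁ refl) = trans (join-b a b r a≢b) (sym Fb≡a)
    ... | inj₂ (inj₂ x∈')  = trans (join-rest x x∈') (agree x x∈')

    agrees-join : (F : Point → Point) → (∀ x → R x → F x ≡ f x) →
      F a ≡ b × F b ≡ a × (∀ x → R' x → F x ≡ r x)
    agrees-join F agree =
      trans (agree a a∈) (join-a a b r) ,
      trans (agree b b∈) (join-b a b r a≢b) ,
      λ x x∈ → trans (agree x (sub x x∈)) (join-rest x x∈)

  record Good (R : Point → Set) (f : Point → Point) : Set where
    field
      pairing  : PairingOn R f
      adjacent : SameLineAdjacent R f
      monotone : CrossMonotone R f

  record ValidOn (R : Point → Set) (f : Point → Point) : Set where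
    field
      pairing         : PairingOn R f
      nothing-between : NothingBetween R f
      monotone        : CrossMonotone R f

  good⇒valid : ∀ {R f} → Good R f → ValidOn R f
  good⇒valid G = record
    { pairing = Good.pairing G
    ; nothing-between = adjacent⇒nothing-between (Good.adjacent G)
    ; monotone = Good.monotone G }

-- The canonical pairing of a pair of words: reading both words from the
-- left, a leading 2 on line 1 (else on line 2) becomes a segment joining
-- the next two points of that line; two leading 1s become a segment
-- joining the next points of both lines.
module Encoding where

  open Compositions
  open Pairings
  open import Data.Bool using (true; false)
  open import Data.Nat using (suc; _≤_; _<_)
  open import Data.Nat.Properties using (suc-injective; <-asym)
  open import Data.List using ([]; _∷_)
  open import Data.Product using (_,_; proj₁; proj₂)
  open import Data.Sum using (inj₁; inj₂)
  open import Data.Unit using (⊤)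
  open import Data.Empty using (⊥; ⊥-elim)
  open import Relation.Binary.PropositionalEquality using (refl; sym; trans; cong; subst₂)

  canonical : Word → Word → ℕ → ℕ → Point → Point
  canonical (two ∷ w₁) w₂ i j =
    join (false , i) (false , suc i) (canonical w₁ w₂ (suc (suc i)) j)
  canonical [] (two ∷ w₂) i j =
    join (true , j) (true , suc j) (canonical [] w₂ i (suc (suc j)))
  canonical (one ∷ w₁) (two ∷ w₂) i j =
    join (true , j) (true , suc j) (canonical (one ∷ w₁) w₂ i (suc (suc j)))
  canonical (one ∷ w₁) (one ∷ w₂) i j =
    join (false , i) (true , j) (canonical w₁ w₂ (suc i) (suc j))
  canonical _ _ i j = λ x → x   -- all points placed, or incompatible words

  NoLeadingTwo : Word → Set
  NoLeadingTwo (two ∷ _) = ⊥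
  NoLeadingTwo _         = ⊤

  canonical-two₂ : ∀ w₁ w₂ i j → NoLeadingTwo w₁ → ∀ x →
    canonical w₁ (two ∷ w₂) i j x ≡ join (true , j) (true , suc j) (canonical w₁ w₂ i (suc (suc j))) x
  canonical-two₂ []         w₂ i j _ x = refl
  canonical-two₂ (one ∷ w₁) w₂ i j _ x = refl

  good-two₁ : ∀ {i j a b} r → Good (Window (suc (suc i)) j a b) r →
    Good (Window i j (suc (suc a)) b) (join (false , i) (false , suc i) r)
  good-two₁ r G = record
    { pairing  = join-pairing (Good.pairing G)
    ; adjacent = join-adjacent (λ _ → inj₁ refl) (Good.adjacent G)
    ; monotone = join-monotone-same-line refl (Good.monotone G) }
    where open JoinLemmas split₁ r

  good-two₂ : ∀ {i j a b} r → Good (Window i (suc (suc j)) a b) r →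
    Good (Window i j a (suc (suc b))) (join (true , j) (true , suc j) r)
  good-two₂ r G = record
    { pairing  = join-pairing (Good.pairing G)
    ; adjacent = join-adjacent (λ _ → inj₁ refl) (Good.adjacent G)
    ; monotone = join-monotone-same-line refl (Good.monotone G) }
    where open JoinLemmas split₂ r

  second-line-from : ∀ {i j a b} x → Window i j a b x → proj₁ x ≡ true → j ≤ proj₂ x
  second-line-from (true , m) (j≤m , _) _ = j≤m

  -- The new cross segment joins the first points of both lines, so it
  -- lies to the left of every other cross segment.
  good-cross : ∀ {i j a b} r → Good (Window (suc i) (suc j) a b) r →
    Good (Window i j (suc a) (suc b)) (join (false , i) (true , j) r)
  good-cross {i} {j} {a} {b} r G = record
    { pairing  = join-pairing (Good.pairing G)
    ; adjacent = join-adjacent (λ ()) (Good.adjacent G)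
    ; monotone = monotone }
    where
    open JoinLemmas split× r
    open Split (split× {i} {j} {a} {b})
    monotone : CrossMonotone (Window i j (suc a) (suc b)) (join (false , i) (true , j) r)
    monotone m m' m∈ m'∈ fm fm' m<m' with cases (false , m) m∈ | cases (false , m') m'∈
    ... | inj₁ refl         | inj₁ refl          = ⊥-elim (<-asym m<m' m<m')
    ... | inj₂ (inj₁ ())    | _
    ... | _                 | inj₂ (inj₁ ())
    ... | inj₂ (inj₂ m∈')   | inj₁ refl          = ⊥-elim (<-asym m<m' (proj₁ m∈'))
    ... | inj₁ refl         | inj₂ (inj₂ m'∈')   =
      subst₂ _<_ (sym (cong proj₂ (join-a (false , i) (true , j) r)))
                 (sym (cong proj₂ (join-rest _ m'∈')))
        (second-line-from (r (false , m')) (PairingOn.closed (Good.pairing G) _ m'∈')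
           (trans (sym (cong proj₁ (join-rest _ m'∈'))) fm'))
    ... | inj₂ (inj₂ m∈')   | inj₂ (inj₂ m'∈')   =
      join-monotone-rest (Good.monotone G) m m' m∈' m'∈' fm fm' m<m'

  canonical-good : ∀ w₁ w₂ i j → ones w₁ ≡ ones w₂ →
    Good (Window i j (total w₁) (total w₂)) (canonical w₁ w₂ i j)
  canonical-good (two ∷ w₁) w₂ i j o =
    good-two₁ _ (canonical-good w₁ w₂ (suc (suc i)) j o)
  canonical-good [] (two ∷ w₂) i j o =
    good-two₂ _ (canonical-good [] w₂ i (suc (suc j)) o)
  canonical-good (one ∷ w₁) (two ∷ w₂) i j o =
    good-two₂ _ (canonical-good (one ∷ w₁) w₂ i (suc (suc j)) o)
  canonical-good (one ∷ w₁) (one ∷ w₂) i j o =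
    good-cross _ (canonical-good w₁ w₂ (suc i) (suc j) (suc-injective o))
  canonical-good [] [] i j _ = record
    { pairing  = record
      { closed         = λ x x∈ → ⊥-elim (empty-window x x∈)
      ; involutive     = λ x x∈ → ⊥-elim (empty-window x x∈)
      ; no-fixed-point = λ x x∈ → ⊥-elim (empty-window x x∈) }
    ; adjacent = λ x x∈ → ⊥-elim (empty-window x x∈)
    ; monotone = λ m _ m∈ → ⊥-elim (empty-window {i} {j} (false , m) m∈) }

  canonical-one-crosses : ∀ w₁ w₂ i j → ones (one ∷ w₁) ≡ ones w₂ →
    proj₁ (canonical (one ∷ w₁) w₂ i j (false , i)) ≡ true
  canonical-one-crosses w₁ (two ∷ w₂) i j o =
    trans (cong proj₁ (join-other (true , j) (true , suc j) (canonical (one ∷ w₁) w₂ i (suc (suc j)))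
                                  (false , i) (λ ()) (λ ())))
          (canonical-one-crosses w₁ w₂ i (suc (suc j)) o)
  canonical-one-crosses w₁ (one ∷ w₂) i j o = cong proj₁ (join-a (false , i) (true , j) _)

-- Reading a pairing F of the window (0, 0, p, q) back into a pair of
-- words, by the same left-to-right scan that builds canonical pairings.
module Decoding (p q : ℕ) (F : Pairings.Point → Pairings.Point) where

  open Compositions
  open Pairings
  open Encoding
  open import Data.Bool using (true; false)
  open import Data.Nat using (zero; suc; _+_; _≤_; _<_; z≤n; s≤s; s≤s⁻¹; _<?_)
  open import Data.Nat.Properties
    using (suc-injective; ≤-refl; <⇒≤; <⇒≱; <-irrefl; <-trans; ≤-<-trans; n<1+n; m<m+n; +-suc;
           +-comm; +-identityʳ; m≤n⇒m<n∨m≡n)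
  open import Data.List using ([]; _∷_)
  open import Data.Product using (Σ; _×_; _,_; proj₁; proj₂; map₁; map₂)
  import Data.Product as Product
  open import Data.Sum using (_⊎_; inj₁; inj₂)
  open import Data.Unit using (tt)
  open import Data.Empty using (⊥-elim)
  open import Relation.Nullary using (¬_; yes; no)
  open import Relation.Nullary.Decidable using (_×-dec_)
  open import Relation.Binary.PropositionalEquality using (refl; sym; trans; cong; subst; subst₂)

  PairedOnFirst : ℕ → Set
  PairedOnFirst i = i < p × F (false , i) ≡ (false , suc i)

  PairedOnSecond : ℕ → Set
  PairedOnSecond j = j < q × F (true , j) ≡ (true , suc j)

  data Next (i j : ℕ) : Set where
    two₁  : PairedOnFirst i → Next i j
    two₂  : ¬ PairedOnFirst i → PairedOnSecond j → Next i j
    cross : ¬ PairedOnFirst i → ¬ PairedOnSecond j → i < p → j < q → Next i j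
    stop  : ¬ PairedOnFirst i → ¬ PairedOnSecond j → ¬ (i < p × j < q) → Next i j

  next : ∀ i j → Next i j
  next i j with (i <? p) ×-dec (F (false , i) ≟ₚ (false , suc i))
  ... | yes pair₁ = two₁ pair₁
  ... | no ¬pair₁ with (j <? q) ×-dec (F (true , j) ≟ₚ (true , suc j))
  ...   | yes pair₂ = two₂ ¬pair₁ pair₂
  ...   | no ¬pair₂ with (i <? p) ×-dec (j <? q)
  ...     | yes (i<p , j<q) = cross ¬pair₁ ¬pair₂ i<p j<q
  ...     | no ¬both        = stop ¬pair₁ ¬pair₂ ¬both

  decodeFrom : ℕ → ℕ → ℕ → Word × Word
  decodeFrom zero    i j = [] , []
  decodeFrom (suc n) i j with next i j
  ... | two₁ _        = map₁ (two ∷_) (decodeFrom n (suc (suc i)) j)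
  ... | two₂ _ _      = map₂ (two ∷_) (decodeFrom n i (suc (suc j)))
  ... | cross _ _ _ _ = Product.map (one ∷_) (one ∷_) (decodeFrom n (suc i) (suc j))
  ... | stop _ _ _    = [] , []

  -- Each step consumes a point, so p + q steps suffice.
  decode : Word × Word
  decode = decodeFrom (p + q) 0 0

  decodeFrom-no-leading-two : ∀ n i j → ¬ PairedOnFirst i →
    NoLeadingTwo (proj₁ (decodeFrom n i j))
  decodeFrom-no-leading-two zero    i j _ = tt
  decodeFrom-no-leading-two (suc n) i j ¬pair₁ with next i j
  ... | two₁ pair₁    = ⊥-elim (¬pair₁ pair₁)
  ... | two₂ _ _      = decodeFrom-no-leading-two n i (suc (suc j)) ¬pair₁
  ... | cross _ _ _ _ = tt
  ... | stop _ _ _    = tt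

  -- The window (i, j, a, b) consists of the last a points of line 1 and
  -- the last b points of line 2.
  record Tail (i j a b : ℕ) : Set where
    constructor tail
    field
      ends₁ : i + a ≡ p
      ends₂ : j + b ≡ q

  tail-in-full : ∀ {i j a b} → Tail i j a b → ∀ x → Window i j a b x → Window 0 0 p q x
  tail-in-full (tail i+a≡p _) (false , m) (_ , m<) = z≤n , subst (m <_) i+a≡p m<
  tail-in-full (tail _ j+b≡q) (true  , m) (_ , m<) = z≤n , subst (m <_) j+b≡q m<

  first₁-in-tail : ∀ {i j a b} → Tail i j (suc a) b → i < p
  first₁-in-tail {i} {a = a} (tail i+a≡p _) = subst (i <_) i+a≡p (m<m+n i (s≤s z≤n))

  first₂-in-tail : ∀ {i j a b} → Tail i j a (suc b) → j < q
  first₂-in-tail {j = j} {b = b} (tail _ j+b≡q) = subst (j <_) j+b≡q (m<m+n j (s≤s z≤n))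

  empty-tail₁ : ∀ {i j b} → Tail i j 0 b → ¬ i < p
  empty-tail₁ {i} (tail i+0≡p _) = <-irrefl (trans (sym (+-identityʳ i)) i+0≡p)

  empty-tail₂ : ∀ {i j a} → Tail i j a 0 → ¬ j < q
  empty-tail₂ {j = j} (tail _ j+0≡q) = <-irrefl (trans (sym (+-identityʳ j)) j+0≡q)

  short-tail₁ : ∀ {i j b} → Tail i j 1 b → ¬ suc i < p
  short-tail₁ {i} (tail i+1≡p _) = <-irrefl (trans (sym (+-comm i 1)) i+1≡p)

  short-tail₂ : ∀ {i j a} → Tail i j a 1 → ¬ suc j < q
  short-tail₂ {j = j} (tail _ j+1≡q) = <-irrefl (trans (sym (+-comm j 1)) j+1≡q)

  full-below : ∀ ℓ {c m} → c < m → Window 0 0 p q (ℓ , m) → Window 0 0 p q (ℓ , c)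
  full-below false c<m (_ , m<p) = z≤n , <-trans c<m m<p
  full-below true  c<m (_ , m<q) = z≤n , <-trans c<m m<q

  no-room : ∀ i → ¬ i < i + 0
  no-room i i<i+0 = <-irrefl (sym (+-identityʳ i)) i<i+0

  +-suc₂ : ∀ m n → m + suc (suc n) ≡ suc (suc (m + n))
  +-suc₂ m n = trans (+-suc m (suc n)) (cong suc (+-suc m n))

  Decodes : ℕ → ℕ → ℕ → ℕ → Word × Word → Set
  Decodes i j a b w =
    Compatible a b (proj₁ w) (proj₂ w) ×
    (∀ x → Window i j a b x → canonical (proj₁ w) (proj₂ w) i j x ≡ F x)

  decodes-nothing : ∀ {i j} → Decodes i j 0 0 ([] , [])
  decodes-nothing = compatible refl refl refl , λ x x∈ → ⊥-elim (empty-window x x∈)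

  module Soundness (V : ValidOn (Window 0 0 p q) F) where

    private
      module V = ValidOn V
      module P = PairingOn V.pairing

    Closed : ℕ → ℕ → ℕ → ℕ → Set
    Closed i j a b = ∀ x → Window i j a b x → Window i j a b (F x)

    tail-pairing : ∀ {i j a b} → Tail i j a b → Closed i j a b → PairingOn (Window i j a b) F
    tail-pairing t closed = record
      { closed         = closed
      ; involutive     = λ x x∈ → P.involutive x (tail-in-full t x x∈)
      ; no-fixed-point = λ x x∈ → P.no-fixed-point x (tail-in-full t x x∈) }

    partner : ∀ {x y} → Window 0 0 p q x → F x ≡ y → F y ≡ x
    partner x∈ refl = P.involutive _ x∈

    -- A point joined to a point to its right on the same line is joined to
    -- its right neighbour, since no point lies on a segment.
    joined-to-neighbour : ∀ ℓ n m → Window 0 0 p q (ℓ , n) → F (ℓ , n) ≡ (ℓ , m) → n ≤ m →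
      F (ℓ , n) ≡ (ℓ , suc n)
    joined-to-neighbour ℓ n m n∈ Fn≡m n≤m with m≤n⇒m<n∨m≡n n≤m
    ... | inj₂ refl = ⊥-elim (P.no-fixed-point (ℓ , n) n∈ Fn≡m)
    ... | inj₁ n<m with m≤n⇒m<n∨m≡n n<m
    ...   | inj₂ refl  = Fn≡m
    ...   | inj₁ 1+n<m = ⊥-elim (V.nothing-between ℓ n (suc n) n∈
                           (full-below ℓ 1+n<m (subst (Window 0 0 p q) Fn≡m (P.closed (ℓ , n) n∈)))
                           (cong proj₁ Fn≡m) (n<1+n n) (subst (suc n <_) (sym (cong proj₂ Fn≡m)) 1+n<m))

    first-crosses : ∀ {i j a b} → Tail i j a b → Closed i j a b → Window i j a b (false , i) →
      ¬ F (false , i) ≡ (false , suc i) →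
      Σ ℕ λ m → F (false , i) ≡ (true , m) × Window i j a b (true , m)
    first-crosses {i} t closed i∈ ¬pair with F (false , i) in Fi≡ | closed (false , i) i∈
    ... | true  , m | m∈      = m , refl , m∈
    ... | false , m | i≤m , _ =
      ⊥-elim (¬pair (trans (sym Fi≡)
        (joined-to-neighbour false i m (tail-in-full t (false , i) i∈) Fi≡ i≤m)))

    second-crosses : ∀ {i j a b} → Tail i j a b → Closed i j a b → Window i j a b (true , j) →
      ¬ F (true , j) ≡ (true , suc j) →
      Σ ℕ λ m → F (true , j) ≡ (false , m) × Window i j a b (false , m)
    second-crosses {j = j} t closed j∈ ¬pair with F (true , j) in Fj≡ | closed (true , j) j∈
    ... | false , m | m∈      = m , refl , m∈
    ... | true  , m | j≤m , _ =
      ⊥-elim (¬pair (trans (sym Fj≡)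
        (joined-to-neighbour true j m (tail-in-full t (true , j) j∈) Fj≡ j≤m)))

    -- If neither first point is joined to its neighbour, they are joined to
    -- each other: otherwise their segments to the other line would cross.
    firsts-joined : ∀ {i j a b} → Tail i j a b → Closed i j a b →
      Window i j a b (false , i) → Window i j a b (true , j) →
      ¬ F (false , i) ≡ (false , suc i) → ¬ F (true , j) ≡ (true , suc j) →
      F (false , i) ≡ (true , j)
    firsts-joined {i} {j} t closed i∈ j∈ ¬pair₁ ¬pair₂
      with first-crosses t closed i∈ ¬pair₁ | second-crosses t closed j∈ ¬pair₂
    ... | m , Fi≡m , (j≤m , _) | m' , Fj≡m' , m'∈ = by-cases (m≤n⇒m<n∨m≡n (proj₁ m'∈))
      where
      Fm'≡j : F (false , m') ≡ (true , j)
      Fm'≡j = partner (tail-in-full t (true , j) j∈) Fj≡m'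
      by-cases : i < m' ⊎ i ≡ m' → F (false , i) ≡ (true , j)
      by-cases (inj₂ i≡m') = subst (λ k → F (false , k) ≡ (true , j)) (sym i≡m') Fm'≡j
      by-cases (inj₁ i<m') = ⊥-elim (<⇒≱ m<j j≤m)
        where
        m<j : m < j
        m<j = subst₂ _<_ (cong proj₂ Fi≡m) (cong proj₂ Fm'≡j)
                (V.monotone i m' (tail-in-full t (false , i) i∈) (tail-in-full t (false , m') m'∈)
                   (cong proj₁ Fi≡m) (cong proj₁ Fm'≡j) i<m')

    Sound : ℕ → Set
    Sound n = ∀ i j a b → Tail i j a b → a + b ≤ n → Closed i j a b →
      Decodes i j a b (decodeFrom n i j)

    sound-two₁ : ∀ n i j a b → Tail i j a b → a + b ≤ suc n → Closed i j a b →
      PairedOnFirst i → Sound n →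
      Decodes i j a b (map₁ (two ∷_) (decodeFrom n (suc (suc i)) j))
    sound-two₁ n i j zero b t _ _ (i<p , _) _ = ⊥-elim (empty-tail₁ t i<p)
    sound-two₁ n i j (suc zero) b t _ _ (i<p , Fi≡) _ = ⊥-elim (short-tail₁ t (proj₂ Fi∈))
      where
      Fi∈ : Window 0 0 p q (false , suc i)
      Fi∈ = subst (Window 0 0 p q) Fi≡ (P.closed (false , i) (z≤n , i<p))
    sound-two₁ n i j (suc (suc a)) b t@(tail i+a≡p j+b≡q) fuel closed (i<p , Fi≡) IH =
      compatible-two₁ (proj₁ rest) , join-agrees F Fi≡ (partner (z≤n , i<p) Fi≡) (proj₂ rest)
      where
      w : Word × Word
      w = decodeFrom n (suc (suc i)) j
      open JoinLemmas (split₁ {i} {j} {a} {b}) (canonical (proj₁ w) (proj₂ w) (suc (suc i)) j)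
      rest : Decodes (suc (suc i)) j a b w
      rest = IH (suc (suc i)) j a b (tail (trans (sym (+-suc₂ i a)) i+a≡p) j+b≡q)
               (<⇒≤ (s≤s⁻¹ fuel))
               (closed-rest F (tail-pairing t closed) Fi≡)

    sound-two₂ : ∀ n i j a b → Tail i j a b → a + b ≤ suc n → Closed i j a b →
      ¬ PairedOnFirst i → PairedOnSecond j → Sound n →
      Decodes i j a b (map₂ (two ∷_) (decodeFrom n i (suc (suc j))))
    sound-two₂ n i j a zero t _ _ _ (j<q , _) _ = ⊥-elim (empty-tail₂ t j<q)
    sound-two₂ n i j a (suc zero) t _ _ _ (j<q , Fj≡) _ = ⊥-elim (short-tail₂ t (proj₂ Fj∈))
      where
      Fj∈ : Window 0 0 p q (true , suc j)
      Fj∈ = subst (Window 0 0 p q) Fj≡ (P.closed (true , j) (z≤n , j<q))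
    sound-two₂ n i j a (suc (suc b)) t@(tail i+a≡p j+b≡q) fuel closed ¬pair₁ (j<q , Fj≡) IH =
      compatible-two₂ (proj₁ rest) ,
      λ x x∈ → trans (canonical-two₂ w₁ w₂ i j no-two x)
                     (join-agrees F Fj≡ (partner (z≤n , j<q) Fj≡) (proj₂ rest) x x∈)
      where
      w₁ w₂ : Word
      w₁ = proj₁ (decodeFrom n i (suc (suc j)))
      w₂ = proj₂ (decodeFrom n i (suc (suc j)))
      no-two : NoLeadingTwo w₁
      no-two = decodeFrom-no-leading-two n i (suc (suc j)) ¬pair₁
      open JoinLemmas (split₂ {i} {j} {a} {b}) (canonical w₁ w₂ i (suc (suc j)))
      rest : Decodes i (suc (suc j)) a b (decodeFrom n i (suc (suc j)))
      rest = IH i (suc (suc j)) a b (tail i+a≡p (trans (sym (+-suc₂ j b)) j+b≡q))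
               (<⇒≤ (s≤s⁻¹ (subst (_≤ suc n) (+-suc₂ a b) fuel)))
               (closed-rest F (tail-pairing t closed) Fj≡)

    sound-cross : ∀ n i j a b → Tail i j a b → a + b ≤ suc n → Closed i j a b →
      ¬ PairedOnFirst i → ¬ PairedOnSecond j → i < p → j < q → Sound n →
      Decodes i j a b (Product.map (one ∷_) (one ∷_) (decodeFrom n (suc i) (suc j)))
    sound-cross n i j zero b t _ _ _ _ i<p _ _ = ⊥-elim (empty-tail₁ t i<p)
    sound-cross n i j (suc a) zero t _ _ _ _ _ j<q _ = ⊥-elim (empty-tail₂ t j<q)
    sound-cross n i j (suc a) (suc b) t@(tail i+a≡p j+b≡q) fuel closed ¬pair₁ ¬pair₂ i<p j<q IH =
      compatible-ones (proj₁ rest) , join-agrees F Fi≡j (partner (z≤n , i<p) Fi≡j) (proj₂ rest)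
      where
      w : Word × Word
      w = decodeFrom n (suc i) (suc j)
      open JoinLemmas (split× {i} {j} {a} {b}) (canonical (proj₁ w) (proj₂ w) (suc i) (suc j))
      Fi≡j : F (false , i) ≡ (true , j)
      Fi≡j = firsts-joined t closed (Split.a∈ (split× {i} {j} {a} {b})) (Split.b∈ (split× {i} {j} {a} {b}))
               (λ Fi≡ → ¬pair₁ (i<p , Fi≡)) (λ Fj≡ → ¬pair₂ (j<q , Fj≡))
      rest : Decodes (suc i) (suc j) a b w
      rest = IH (suc i) (suc j) a b
               (tail (trans (sym (+-suc i a)) i+a≡p) (trans (sym (+-suc j b)) j+b≡q))
               (<⇒≤ (subst (_≤ n) (+-suc a b) (s≤s⁻¹ fuel)))
               (closed-rest F (tail-pairing t closed) Fi≡j)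

    sound-stop : ∀ i j a b → Tail i j a b → Closed i j a b →
      ¬ PairedOnFirst i → ¬ PairedOnSecond j → ¬ (i < p × j < q) → Decodes i j a b ([] , [])
    sound-stop i j zero    zero    _ _ _ _ _ = decodes-nothing
    sound-stop i j (suc a) (suc b) t _ _ _ ¬both =
      ⊥-elim (¬both (first₁-in-tail t , first₂-in-tail t))
    sound-stop i j (suc a) zero t closed ¬pair₁ _ _
      with first-crosses t closed (Peel.a∈ (peel₁ {i} {j} {a} {0}))
             (λ Fi≡ → ¬pair₁ (first₁-in-tail t , Fi≡))
    ... | m , _ , (j≤m , m<j+0) = ⊥-elim (no-room j (≤-<-trans j≤m m<j+0))
    sound-stop i j zero (suc b) t closed _ ¬pair₂ _
      with second-crosses t closed (Peel.a∈ (peel₂ {i} {j} {0} {b}))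
             (λ Fj≡ → ¬pair₂ (first₂-in-tail t , Fj≡))
    ... | m , _ , (i≤m , m<i+0) = ⊥-elim (no-room i (≤-<-trans i≤m m<i+0))

    sound : ∀ n → Sound n
    sound zero    i j zero zero _ _ _ = decodes-nothing
    sound (suc n) i j a b t fuel closed with next i j
    ... | two₁ pair₁ = sound-two₁ n i j a b t fuel closed pair₁ (sound n)
    ... | two₂ ¬pair₁ pair₂ = sound-two₂ n i j a b t fuel closed ¬pair₁ pair₂ (sound n)
    ... | cross ¬pair₁ ¬pair₂ i<p j<q =
      sound-cross n i j a b t fuel closed ¬pair₁ ¬pair₂ i<p j<q (sound n)
    ... | stop ¬pair₁ ¬pair₂ ¬both = sound-stop i j a b t closed ¬pair₁ ¬pair₂ ¬both

    decode-sound : Decodes 0 0 p q decode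
    decode-sound = sound (p + q) 0 0 p q (tail refl refl) ≤-refl P.closed

  decode-two₁ : ∀ n i j → PairedOnFirst i →
    decodeFrom (suc n) i j ≡ map₁ (two ∷_) (decodeFrom n (suc (suc i)) j)
  decode-two₁ n i j pair₁ with next i j
  ... | two₁ _            = refl
  ... | two₂ ¬pair₁ _     = ⊥-elim (¬pair₁ pair₁)
  ... | cross ¬pair₁ _ _ _ = ⊥-elim (¬pair₁ pair₁)
  ... | stop ¬pair₁ _ _   = ⊥-elim (¬pair₁ pair₁)

  decode-two₂ : ∀ n i j → ¬ PairedOnFirst i → PairedOnSecond j →
    decodeFrom (suc n) i j ≡ map₂ (two ∷_) (decodeFrom n i (suc (suc j)))
  decode-two₂ n i j ¬pair₁ pair₂ with next i j
  ... | two₁ pair₁         = ⊥-elim (¬pair₁ pair₁)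
  ... | two₂ _ _           = refl
  ... | cross _ ¬pair₂ _ _ = ⊥-elim (¬pair₂ pair₂)
  ... | stop _ ¬pair₂ _    = ⊥-elim (¬pair₂ pair₂)

  decode-cross : ∀ n i j → ¬ PairedOnSecond j → F (false , i) ≡ (true , j) → i < p → j < q →
    decodeFrom (suc n) i j ≡ Product.map (one ∷_) (one ∷_) (decodeFrom n (suc i) (suc j))
  decode-cross n i j ¬pair₂ Fi≡j i<p j<q with next i j
  ... | two₁ (_ , Fi≡)    = ⊥-elim (false≢true (cong proj₁ (trans (sym Fi≡) Fi≡j)))
  ... | two₂ _ pair₂      = ⊥-elim (¬pair₂ pair₂)
  ... | cross _ _ _ _     = refl
  ... | stop _ _ ¬both    = ⊥-elim (¬both (i<p , j<q))

  decode-stop : ∀ n i j → ¬ i < p → ¬ j < q → decodeFrom n i j ≡ ([] , [])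
  decode-stop zero    i j _ _ = refl
  decode-stop (suc n) i j i≮p j≮q with next i j
  ... | two₁ (i<p , _)   = ⊥-elim (i≮p i<p)
  ... | two₂ _ (j<q , _) = ⊥-elim (j≮q j<q)
  ... | cross _ _ i<p _  = ⊥-elim (i≮p i<p)
  ... | stop _ _ _       = refl

  Agrees : ℕ → ℕ → Word → Word → Set
  Agrees i j w₁ w₂ = ∀ x → Window i j (total w₁) (total w₂) x → F x ≡ canonical w₁ w₂ i j x

  decodeFrom-canonical : ∀ w₁ w₂ n i j → ones w₁ ≡ ones w₂ →
    Tail i j (total w₁) (total w₂) → total w₁ + total w₂ ≤ n → Agrees i j w₁ w₂ →
    decodeFrom n i j ≡ (w₁ , w₂)

  -- The case of a leading 2 on line 2 only, shared by two shapes of words.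
  decodeFrom-canonical₂ : ∀ w₁ w₂ n i j → NoLeadingTwo w₁ → ones w₁ ≡ ones w₂ →
    Tail i j (total w₁) (total (two ∷ w₂)) → total w₁ + total (two ∷ w₂) ≤ suc n →
    Agrees i j w₁ (two ∷ w₂) → decodeFrom (suc n) i j ≡ (w₁ , two ∷ w₂)

  decodeFrom-canonical [] [] n i j _ t _ _ = decode-stop n i j (empty-tail₁ t) (empty-tail₂ t)
  decodeFrom-canonical (two ∷ w₁) w₂ (suc n) i j o t@(tail i+a≡p j+b≡q) fuel agree
    with JoinLemmas.agrees-join split₁ (canonical w₁ w₂ (suc (suc i)) j) F agree
  ... | Fi≡ , _ , agree' =
    trans (decode-two₁ n i j (first₁-in-tail t , Fi≡))
      (cong (map₁ (two ∷_)) (decodeFrom-canonical w₁ w₂ n (suc (suc i)) j o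
        (tail (trans (sym (+-suc₂ i (total w₁))) i+a≡p) j+b≡q) (<⇒≤ (s≤s⁻¹ fuel)) agree'))
  decodeFrom-canonical [] (two ∷ w₂) (suc n) i j o t fuel agree =
    decodeFrom-canonical₂ [] w₂ n i j tt o t fuel agree
  decodeFrom-canonical (one ∷ w₁) (two ∷ w₂) (suc n) i j o t fuel agree =
    decodeFrom-canonical₂ (one ∷ w₁) w₂ n i j tt o t fuel agree
  decodeFrom-canonical (one ∷ w₁) (one ∷ w₂) (suc n) i j o t@(tail i+a≡p j+b≡q) fuel agree
    with JoinLemmas.agrees-join split× (canonical w₁ w₂ (suc i) (suc j)) F agree
  ... | Fi≡j , Fj≡i , agree' =
    trans (decode-cross n i j (λ (_ , Fj≡) → false≢true (cong proj₁ (trans (sym Fj≡i) Fj≡))) Fi≡j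
             (first₁-in-tail t) (first₂-in-tail t))
      (cong (Product.map (one ∷_) (one ∷_))
        (decodeFrom-canonical w₁ w₂ n (suc i) (suc j) (suc-injective o)
        (tail (trans (sym (+-suc i (total w₁))) i+a≡p) (trans (sym (+-suc j (total w₂))) j+b≡q))
        (<⇒≤ (subst (_≤ n) (+-suc (total w₁) (total w₂)) (s≤s⁻¹ fuel))) agree'))

  decodeFrom-canonical₂ w₁ w₂ n i j no-two o t@(tail i+a≡p j+b≡q) fuel agree
    with JoinLemmas.agrees-join split₂ (canonical w₁ w₂ i (suc (suc j))) F
           (λ x x∈ → trans (agree x x∈) (canonical-two₂ w₁ w₂ i j no-two x))
  ... | Fj≡ , _ , agree' =
    trans (decode-two₂ n i j (not-paired₁ w₁ no-two o t agree) (first₂-in-tail t , Fj≡))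
      (cong (map₂ (two ∷_)) (decodeFrom-canonical w₁ w₂ n i (suc (suc j)) o
        (tail i+a≡p (trans (sym (+-suc₂ j (total w₂))) j+b≡q))
        (<⇒≤ (s≤s⁻¹ (subst (_≤ suc n) (+-suc₂ (total w₁) (total w₂)) fuel))) agree'))
    where
    not-paired₁ : ∀ w₁ → NoLeadingTwo w₁ → ones w₁ ≡ ones w₂ →
      Tail i j (total w₁) (total (two ∷ w₂)) →
      Agrees i j w₁ (two ∷ w₂) → ¬ PairedOnFirst i
    not-paired₁ [] _ _ t _ (i<p , _) = empty-tail₁ t i<p
    not-paired₁ (one ∷ w₁) _ o _ agree (_ , Fi≡) =
      false≢true (trans (sym (cong proj₁ (trans (sym (agree (false , i) i∈)) Fi≡)))
                        (canonical-one-crosses w₁ (two ∷ w₂) i j o))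
      where
      i∈ : Window i j (total (one ∷ w₁)) (total (two ∷ w₂)) (false , i)
      i∈ = Peel.a∈ (peel₁ {i} {j} {total w₁} {total (two ∷ w₂)})

module Transport (p q : ℕ) where

  open Pairings
  open import Data.Bool using (true; false)
  open import Data.Nat using (_+_; z≤n; _<_; _<?_)
  open import Data.Fin using (Fin; toℕ; splitAt; _↑ˡ_; _↑ʳ_; fromℕ<)
  open import Data.Fin.Properties
    using (splitAt-↑ˡ; splitAt-↑ʳ; splitAt⁻¹-↑ˡ; splitAt⁻¹-↑ʳ; toℕ<n; fromℕ<-toℕ;
           toℕ-fromℕ<)
  open import Data.Maybe using (Maybe; just; nothing; maybe; fromMaybe)
  open import Data.Maybe.Properties using (just-injective)
  open import Data.Vec using (Vec; lookup; tabulate)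
  open import Data.Vec.Properties using (lookup∘tabulate; tabulate∘lookup; tabulate-cong)
  open import Data.Product using (Σ; _×_; _,_; proj₁; proj₂)
  open import Data.Sum using (_⊎_; inj₁; inj₂)
  open import Data.Empty using (⊥-elim)
  open import Relation.Nullary using (¬_; yes; no)
  open import Relation.Binary.PropositionalEquality
    using (refl; sym; trans; cong; subst; subst₂; module ≡-Reasoning)

  Pairing : Set
  Pairing = Vec (Fin (p + q)) (p + q)

  Full : Point → Set
  Full = Window 0 0 p q

  point : Fin (p + q) → Point
  point x = line p q x , idx p q x

  point-↑ˡ : ∀ (i : Fin p) → point (i ↑ˡ q) ≡ (false , toℕ i)
  point-↑ˡ i rewrite splitAt-↑ˡ p i q = refl

  point-↑ʳ : ∀ (j : Fin q) → point (p ↑ʳ j) ≡ (true , toℕ j)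
  point-↑ʳ j rewrite splitAt-↑ʳ p q j = refl

  on-first-or-second : ∀ x → (Σ (Fin p) λ i → x ≡ i ↑ˡ q) ⊎ (Σ (Fin q) λ j → x ≡ p ↑ʳ j)
  on-first-or-second x with splitAt p x in eq
  ... | inj₁ i = inj₁ (i , sym (splitAt⁻¹-↑ˡ eq))
  ... | inj₂ j = inj₂ (j , sym (splitAt⁻¹-↑ʳ eq))

  point-full : ∀ x → Full (point x)
  point-full x with on-first-or-second x
  ... | inj₁ (i , refl) rewrite point-↑ˡ i = z≤n , toℕ<n i
  ... | inj₂ (j , refl) rewrite point-↑ʳ j = z≤n , toℕ<n j

  index? : Point → Maybe (Fin (p + q))
  index? (false , m) with m <? p
  ... | yes m<p = just (fromℕ< m<p ↑ˡ q)
  ... | no _    = nothing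
  index? (true , m) with m <? q
  ... | yes m<q = just (p ↑ʳ fromℕ< m<q)
  ... | no _    = nothing

  index?-point : ∀ x → index? (point x) ≡ just x
  index?-point x with on-first-or-second x
  ... | inj₁ (i , refl) rewrite point-↑ˡ i with toℕ i <? p
  ...   | yes i<p = cong (λ i → just (i ↑ˡ q)) (fromℕ<-toℕ i i<p)
  ...   | no i≮p  = ⊥-elim (i≮p (toℕ<n i))
  index?-point x | inj₂ (j , refl) rewrite point-↑ʳ j with toℕ j <? q
  ...   | yes j<q = cong (λ j → just (p ↑ʳ j)) (fromℕ<-toℕ j j<q)
  ...   | no j≮q  = ⊥-elim (j≮q (toℕ<n j))

  index?-full : ∀ pt → Full pt → Σ (Fin (p + q)) λ x → index? pt ≡ just x × point x ≡ pt
  index?-full (false , m) (_ , m<p) with m <? p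
  ... | yes m<p' = _ , refl , trans (point-↑ˡ _) (cong (false ,_) (toℕ-fromℕ< m<p'))
  ... | no m≮p   = ⊥-elim (m≮p m<p)
  index?-full (true , m) (_ , m<q) with m <? q
  ... | yes m<q' = _ , refl , trans (point-↑ʳ _) (cong (true ,_) (toℕ-fromℕ< m<q'))
  ... | no m≮q   = ⊥-elim (m≮q m<q)

  point-injective : ∀ {x y} → point x ≡ point y → x ≡ y
  point-injective {x} {y} e =
    just-injective (trans (sym (index?-point x)) (trans (cong index? e) (index?-point y)))

  full-point : ∀ pt → Full pt → Σ (Fin (p + q)) λ x → point x ≡ pt
  full-point pt pt∈ with index?-full pt pt∈
  ... | x , _ , px≡pt = x , px≡pt

  Represents : Pairing → (Point → Point) → Set
  Represents v F = ∀ x → F (point x) ≡ point (lookup v x)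

  represents-at : ∀ {v F x pt} → Represents v F → point x ≡ pt → F pt ≡ point (lookup v x)
  represents-at {x = x} rep refl = rep x

  -- The map on points described by a vector (the identity off the full window).
  asMap : Pairing → Point → Point
  asMap v pt = maybe (λ x → point (lookup v x)) pt (index? pt)

  asMap-represents : ∀ v → Represents v (asMap v)
  asMap-represents v x = cong (maybe (λ x → point (lookup v x)) (point x)) (index?-point x)

  asVec : (Point → Point) → Pairing
  asVec F = tabulate (λ x → fromMaybe x (index? (F (point x))))

  asVec-represents : ∀ F → (∀ pt → Full pt → Full (F pt)) → Represents (asVec F) F
  asVec-represents F closed x with index?-full (F (point x)) (closed (point x) (point-full x))
  ... | y , index≡y , py≡Fx =
    trans (sym py≡Fx) (cong point (sym (trans (lookup∘tabulate _ x) (cong (fromMaybe x) index≡y))))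

  represents-unique : ∀ {v v' F F'} → Represents v F → Represents v' F' →
    (∀ pt → Full pt → F pt ≡ F' pt) → v ≡ v'
  represents-unique {v} {v'} rep rep' agree =
    trans (sym (tabulate∘lookup v)) (trans (tabulate-cong same-entries) (tabulate∘lookup v'))
    where
    same-entries : ∀ x → lookup v x ≡ lookup v' x
    same-entries x = point-injective
      (trans (sym (rep x)) (trans (agree (point x) (point-full x)) (rep' x)))

  represents-valid : ∀ v {F} → Represents v F → ValidOn Full F → ValidPairing p q v
  represents-valid v {F} rep V = involutive , no-fixed-point , no-point-on-segment , no-crossing
    where
    module V = ValidOn V
    module P = PairingOn V.pairing
    at : ∀ {x pt} → point x ≡ pt → F pt ≡ point (lookup v x)
    at = represents-at {v} {F} rep
    involutive : Involutive (lookup v)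
    involutive x = point-injective (begin
      point (lookup v (lookup v x)) ≡⟨ rep (lookup v x) ⟨
      F (point (lookup v x))        ≡⟨ cong F (rep x) ⟨
      F (F (point x))               ≡⟨ P.involutive (point x) (point-full x) ⟩
      point x                       ∎)
      where open ≡-Reasoning
    no-fixed-point : FixedPointFree (lookup v)
    no-fixed-point x vx≡x =
      P.no-fixed-point (point x) (point-full x) (trans (rep x) (cong point vx≡x))
    no-point-on-segment : NoPointOnSegment p q (lookup v)
    no-point-on-segment x z same-line z-on-line x<z z<vx =
      V.nothing-between (line p q x) (idx p q x) (idx p q z) (point-full x)
        (subst (λ ℓ → Full (ℓ , idx p q z)) z-on-line (point-full z))
        (trans (cong proj₁ (rep x)) (sym same-line)) x<z
        (subst (λ pt → idx p q z < proj₂ pt) (sym (rep x)) z<vx)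
    no-crossing : NoCrossing p q (lookup v)
    no-crossing x y x₁ vx₂ y₁ vy₂ x<y =
      subst₂ _<_ (cong proj₂ (at on-x)) (cong proj₂ (at on-y))
        (V.monotone (idx p q x) (idx p q y) (subst Full on-x (point-full x)) (subst Full on-y (point-full y))
          (trans (cong proj₁ (at on-x)) vx₂)
          (trans (cong proj₁ (at on-y)) vy₂) x<y)
      where
      on-x : point x ≡ (false , idx p q x)
      on-x = cong (_, idx p q x) x₁
      on-y : point y ≡ (false , idx p q y)
      on-y = cong (_, idx p q y) y₁

  valid-represents : ∀ v {F} → Represents v F → ValidPairing p q v → ValidOn Full F
  valid-represents v {F} rep (involutive , no-fixed-point , no-point-on-segment , no-crossing) =
    record
    { pairing = record { closed = closed ; involutive = involutive' ; no-fixed-point = no-fixed-point' }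
    ; nothing-between = nothing-between
    ; monotone = monotone }
    where
    at : ∀ {x pt} → point x ≡ pt → F pt ≡ point (lookup v x)
    at = represents-at {v} {F} rep
    closed : ∀ pt → Full pt → Full (F pt)
    closed pt pt∈ with full-point pt pt∈
    ... | x , px≡pt = subst Full (sym (at px≡pt)) (point-full (lookup v x))
    involutive' : ∀ pt → Full pt → F (F pt) ≡ pt
    involutive' pt pt∈ with full-point pt pt∈
    ... | x , refl = trans (cong F (rep x)) (trans (rep (lookup v x)) (cong point (involutive x)))
    no-fixed-point' : ∀ pt → Full pt → ¬ F pt ≡ pt
    no-fixed-point' pt pt∈ with full-point pt pt∈
    ... | x , refl = λ Fx≡x → no-fixed-point x (point-injective (trans (sym (rep x)) Fx≡x))
    nothing-between : NothingBetween Full F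
    nothing-between ℓ m c m∈ c∈ same m<c c<Fm with full-point (ℓ , m) m∈ | full-point (ℓ , c) c∈
    ... | x , refl | z , pz≡c =
      no-point-on-segment x z (sym (trans (cong proj₁ (sym (rep x))) same)) (cong proj₁ pz≡c)
        (subst (idx p q x <_) (sym (cong proj₂ pz≡c)) m<c)
        (subst₂ _<_ (sym (cong proj₂ pz≡c)) (cong proj₂ (rep x)) c<Fm)
    monotone : CrossMonotone Full F
    monotone m m' m∈ m'∈ Fm₁ Fm'₁ m<m' with full-point (false , m) m∈ | full-point (false , m') m'∈
    ... | x , px≡m | y , py≡m' =
      subst₂ _<_ (sym (cong proj₂ (at px≡m))) (sym (cong proj₂ (at py≡m')))
        (no-crossing x y (cong proj₁ px≡m) (trans (sym (cong proj₁ (at px≡m))) Fm₁)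
                         (cong proj₁ py≡m') (trans (sym (cong proj₁ (at py≡m'))) Fm'₁)
                         (subst₂ _<_ (sym (cong proj₂ px≡m)) (sym (cong proj₂ py≡m')) m<m'))

module Correspondence (p q : ℕ) where

  open Compositions
  open Pairings
  open Encoding
  open Transport p q
  open import Data.Nat using (_+_; _≤_)
  open import Data.Nat.Properties using (≤-reflexive)
  open import Data.Product using (_×_; _,_; proj₁; proj₂)
  open import Relation.Binary.PropositionalEquality using (refl; sym; trans; cong₂; subst₂)

  pairingOf : Word → Word → Pairing
  pairingOf w₁ w₂ = asVec (canonical w₁ w₂ 0 0)

  wordsOf : Pairing → Word × Word
  wordsOf v = Decoding.decode p q (asMap v)

  canonical-full-good : ∀ {w₁ w₂} → Compatible p q w₁ w₂ → Good Full (canonical w₁ w₂ 0 0)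
  canonical-full-good {w₁} {w₂} (compatible t₁ t₂ o) =
    subst₂ (λ a b → Good (Window 0 0 a b) (canonical w₁ w₂ 0 0)) t₁ t₂
      (canonical-good w₁ w₂ 0 0 o)

  pairingOf-represents : ∀ {w₁ w₂} → Compatible p q w₁ w₂ →
    Represents (pairingOf w₁ w₂) (canonical w₁ w₂ 0 0)
  pairingOf-represents c =
    asVec-represents _ (PairingOn.closed (Good.pairing (canonical-full-good c)))

  pairingOf-valid : ∀ {w₁ w₂} → Compatible p q w₁ w₂ → ValidPairing p q (pairingOf w₁ w₂)
  pairingOf-valid {w₁} {w₂} c =
    represents-valid (pairingOf w₁ w₂) (pairingOf-represents c) (good⇒valid (canonical-full-good c))

  module _ (v : Pairing) (V : ValidPairing p q v) where
    open Decoding p q (asMap v)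
    open Soundness (valid-represents v (asMap-represents v) V)

    wordsOf-compatible : Compatible p q (proj₁ (wordsOf v)) (proj₂ (wordsOf v))
    wordsOf-compatible = proj₁ decode-sound

    pairingOf-wordsOf : pairingOf (proj₁ (wordsOf v)) (proj₂ (wordsOf v)) ≡ v
    pairingOf-wordsOf = represents-unique (pairingOf-represents wordsOf-compatible) (asMap-represents v)
                          (proj₂ decode-sound)

  wordsOf-pairingOf : ∀ {w₁ w₂} → Compatible p q w₁ w₂ →
    wordsOf (pairingOf w₁ w₂) ≡ (w₁ , w₂)
  wordsOf-pairingOf {w₁} {w₂} c@(compatible t₁ t₂ o) =
    decodeFrom-canonical w₁ w₂ (p + q) 0 0 o (tail t₁ t₂) (≤-reflexive (cong₂ _+_ t₁ t₂)) agree
    where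
    v : Pairing
    v = pairingOf w₁ w₂
    open Decoding p q (asMap v)
    agree : Agrees 0 0 w₁ w₂
    agree pt pt∈ with full-point pt (subst₂ (λ a b → Window 0 0 a b pt) t₁ t₂ pt∈)
    ... | x , refl = trans (asMap-represents v x) (sym (pairingOf-represents c x))

module PathsAndPairings (k : ℕ) where

  open Compositions
  open Correspondence k k
  open Transport k k using (Pairing)
  open import Data.List using (List; map)
  open import Data.Product using (_×_; proj₁; proj₂; uncurry)
  open import Relation.Binary.PropositionalEquality using (trans; cong; cong₂)

  encode : List Step → Pairing
  encode ps = pairingOf (map first ps) (map second ps)

  decodePath : Pairing → List Step
  decodePath v = uncurry zipSteps (wordsOf v)

  encode-valid : ∀ ps → Balanced k ps → ValidPairing k k (encode ps)
  encode-valid ps b = pairingOf-valid (balanced⇒compatible k ps b)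

  decode-balanced : ∀ v → ValidPairing k k v → Balanced k (decodePath v)
  decode-balanced v V = compatible⇒balanced k _ _ (wordsOf-compatible v V)

  decode-encode : ∀ ps → Balanced k ps → decodePath (encode ps) ≡ ps
  decode-encode ps b =
    trans (cong (uncurry zipSteps) (wordsOf-pairingOf (balanced⇒compatible k ps b))) (zip-unzip ps)

  encode-decode : ∀ v → ValidPairing k k v → encode (decodePath v) ≡ v
  encode-decode v V =
    trans (cong₂ pairingOf (proj₁ unzipped) (proj₂ unzipped)) (pairingOf-wordsOf v V)
    where
    w₁ w₂ : Word
    w₁ = proj₁ (wordsOf v)
    w₂ = proj₂ (wordsOf v)
    unzipped : map first (zipSteps w₁ w₂) ≡ w₁ × map second (zipSteps w₁ w₂) ≡ w₂
    unzipped = unzip-zip w₁ w₂ (compatible⇒same-length k w₁ w₂ (wordsOf-compatible v V))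

theorem6 : (k : ℕ) → r k ≡ a k k
theorem6 k =
  length-filter-bijection (balanced? k) (validPairing? k k) (pathsUpTo k) (allVecs (k + k) (k + k))
    (pathsUpTo-unique k) (allVecs-unique (k + k) (k + k))
    (λ ps b → pathsUpTo-complete k ps (balanced-length k ps b))
    (λ v _ → allVecs-complete (k + k) (k + k) v)
    encode decodePath encode-valid decode-balanced decode-encode encode-decode
  where
  open Counting
  open Enumerations
  open Compositions using (balanced-length)
  open PathsAndPairings k
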